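{- Let $G$ be a connected bipartite simple graph with bipartition $(V_1,V_2)$ and edge cone $\mathbb{R}_+\mathcal{A}$. If $A$ is a nonempty independent set of $G$ such that $A\neq V_1$ and $A\neq V_2$, then $F=\mathbb{R}_+\mathcal{A}\cap H_A$ is a proper face of $\mathbb{R}_+\mathcal{A}$.
   Context: Let $V(G)=\{v_1,\ldots,v_n\}$ and $e_i$ the $i$-th unit vector of $\mathbb{R}^n$. The edge cone $\mathbb{R}_+\mathcal{A}$ is the cone of nonnegative real combinations of the vectors $e_i+e_j$ with $\{v_i,v_j\}$ an edge of $G$. A set of vertices is independent if no two of its vertices are adjacent; $N(A)$ is the set of vertices adjacent to some vertex of $A$; $H_A=\{x\in\mathbb{R}^n\mid\sum_{v_i\in A}x_i=\sum_{v_i\in N(A)}x_i\}$. A face of a cone $Q$ is $Q\cap H$ for a hyperplane $H$ through the origin with $Q$ on one side of $H$; the faces $Q$ and $\emptyset$ are improper, all others proper.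
   Formalization: The edge cone $\mathbb{R}_+\mathcal{A}$, the hyperplane $H_A$ and the hyperplanes defining faces are taken over ℚ, with points in ℚ^n rather than $\mathbb{R}^n$. -}

module Defs where

open import Data.Bool using (Bool; true; false; _∧_; _∨_; if_then_else_)
open import Data.Nat using (ℕ; zero; suc)
open import Data.Fin using (Fin; zero; suc)
open import Data.Fin.Subset using (Subset; _∈_; _∉_; Nonempty)
open import Data.Vec using (Vec; []; _∷_; lookup; tabulate)
open import Data.Rational using (ℚ; 0ℚ; _+_; _*_; _≤_)
open import Data.Product using (Σ; ∃; _×_; _,_)
open import Data.Sum using (_⊎_)
open import Relation.Binary.PropositionalEquality using (_≡_; _≢_)
open import Relation.Nullary using (¬_)

record Graph (n : ℕ) : Set where
  field
    adj       : Fin n → Fin n → Bool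
    adj-sym   : ∀ i j → adj i j ≡ adj j i
    adj-irrefl : ∀ i → adj i i ≡ false
open Graph public

data Reach {n : ℕ} (G : Graph n) : Fin n → Fin n → Set where
  here : ∀ {i} → Reach G i i
  step : ∀ {i j k} → adj G i j ≡ true → Reach G j k → Reach G i k

Connected : ∀ {n} → Graph n → Set
Connected G = ∀ i j → Reach G i j

IsBipartition : ∀ {n} → Graph n → Subset n → Subset n → Set
IsBipartition {n} G V₁ V₂ =
  (∀ (i : Fin n) → (i ∈ V₁ × i ∉ V₂) ⊎ (i ∈ V₂ × i ∉ V₁)) ×
  (∀ i j → adj G i j ≡ true → (i ∈ V₁ × j ∈ V₂) ⊎ (i ∈ V₂ × j ∈ V₁))

Independent : ∀ {n} → Graph n → Subset n → Set
Independent G A = ∀ i j → i ∈ A → j ∈ A → adj G i j ≡ false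

anyFin : ∀ {n} → (Fin n → Bool) → Bool
anyFin {zero}  p = false
anyFin {suc n} p = p zero ∨ anyFin (λ i → p (suc i))

nbhd : ∀ {n} → Graph n → Subset n → Subset n
nbhd G A = tabulate λ j → anyFin λ i → lookup A i ∧ adj G i j

sumFin : ∀ {n} → (Fin n → ℚ) → ℚ
sumFin {zero}  f = 0ℚ
sumFin {suc n} f = f zero + sumFin (λ i → f (suc i))

sumOver : ∀ {n} → Subset n → (Fin n → ℚ) → ℚ
sumOver S x = sumFin λ i → if lookup S i then x i else 0ℚ

dot : ∀ {n} → (Fin n → ℚ) → (Fin n → ℚ) → ℚ
dot a x = sumFin λ i → a i * x i

VSet : ℕ → Set₁
VSet n = (Fin n → ℚ) → Set

-- The edge cone R₊A: nonnegative combinations of e_i + e_j over edges {v_i,v_j}.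
-- c i j is the coefficient of e_i + e_j (ordered pairs; zero on non-edges).
EdgeCone : ∀ {n} → Graph n → VSet n
EdgeCone {n} G x =
  Σ (Fin n → Fin n → ℚ) λ c →
    (∀ i j → 0ℚ ≤ c i j) ×
    (∀ i j → adj G i j ≡ false → c i j ≡ 0ℚ) ×
    (∀ k → x k ≡ sumFin (λ j → c k j + c j k))

HA : ∀ {n} → Graph n → Subset n → VSet n
HA G A x = sumOver A x ≡ sumOver (nbhd G A) x

IsFace : ∀ {n} → VSet n → VSet n → Set
IsFace {n} Q F =
  Σ (Fin n → ℚ) λ a →
    (∃ λ i → a i ≢ 0ℚ) ×
    ((∀ x → Q x → 0ℚ ≤ dot a x) ⊎ (∀ x → Q x → dot a x ≤ 0ℚ)) ×
    (∀ x → (F x → Q x × dot a x ≡ 0ℚ) × (Q x × dot a x ≡ 0ℚ → F x))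

IsProperFace : ∀ {n} → VSet n → VSet n → Set
IsProperFace Q F =
  IsFace Q F × (∃ λ x → Q x × ¬ F x) × (∃ λ x → F x)

-- The vector a = 1_N(A) − 1_A is normal to H_A. On a generator e_i + e_j of the edge cone it
-- takes the value (1_N(A)(j) − 1_A(i)) + (1_N(A)(i) − 1_A(j)) ≥ 0, since a neighbour of a vertex
-- of A lies in N(A); so H_A supports the cone, and a ≠ 0 because A is nonempty and, being
-- independent, disjoint from N(A). The face contains 0, and it misses e_i + e_j for every edge
-- from N(A) to a vertex outside A. If there were no such edge, then along any walk the vertices
-- would alternate between A and N(A) in step with the two sides of the bipartition, so by
-- connectivity A would be V₁ or V₂.
module Submission where

open import Defs
open import Data.Bool using (Bool; true; false; _∧_; if_then_else_)
open import Data.Bool.Properties using () renaming (_≟_ to _≟ᵇ_)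
open import Data.Fin using (Fin; zero; suc)
open import Data.Fin.Properties using (any?) renaming (_≟_ to _≟ᶠ_)
open import Data.Fin.Subset using (Subset; Nonempty; _∈_; _∉_)
open import Data.Fin.Subset.Properties using (_∈?_; ⊆-antisym)
open import Data.Nat using (ℕ; zero; suc)
open import Data.Product using (∃; ∃₂; _×_; _,_; proj₁; proj₂)
open import Data.Rational using (ℚ; 0ℚ; 1ℚ; _+_; _*_; _-_; -_; _≤_; _<_; nonNegative)
open import Data.Rational.Properties
open import Data.Rational.Solver using (module +-*-Solver)
open import Data.Sum using (_⊎_; inj₁; inj₂; swap)
open import Data.Vec using (lookup)
open import Data.Vec.Properties using (lookup∘tabulate; []=⇒lookup; lookup⇒[]=)
open import Function using (_∘_; _$_)
open import Relation.Binary.PropositionalEquality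
open import Relation.Nullary using (¬_; Dec; yes; no; contradiction)
open import Relation.Nullary.Decidable using (_×-dec_; ¬?)

open import Algebra.Properties.Group +-0-group using (x∙y⁻¹≈ε⇒x≈y; x≈y⇒x∙y⁻¹≈ε)
open +-*-Solver

private
  variable
    n : ℕ

sumFin-cong : {f g : Fin n → ℚ} → (∀ i → f i ≡ g i) → sumFin f ≡ sumFin g
sumFin-cong {zero}  f≗g = refl
sumFin-cong {suc n} f≗g = cong₂ _+_ (f≗g zero) (sumFin-cong (f≗g ∘ suc))

sumFin-zero : (f : Fin n → ℚ) → (∀ i → f i ≡ 0ℚ) → sumFin f ≡ 0ℚ
sumFin-zero {zero}  f f≗0 = refl
sumFin-zero {suc n} f f≗0 = cong₂ _+_ (f≗0 zero) (sumFin-zero (f ∘ suc) (f≗0 ∘ suc))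

sumFin-+ : (f g : Fin n → ℚ) → sumFin (λ i → f i + g i) ≡ sumFin f + sumFin g
sumFin-+ {zero}  f g = refl
sumFin-+ {suc n} f g = begin
  (f zero + g zero) + sumFin (λ i → f (suc i) + g (suc i))
    ≡⟨ cong ((f zero + g zero) +_) (sumFin-+ (f ∘ suc) (g ∘ suc)) ⟩
  (f zero + g zero) + (sumFin (f ∘ suc) + sumFin (g ∘ suc))
    ≡⟨ solve 4 (λ a b c d → (a :+ b) :+ (c :+ d) := (a :+ c) :+ (b :+ d)) refl
         (f zero) (g zero) (sumFin (f ∘ suc)) (sumFin (g ∘ suc)) ⟩
  (f zero + sumFin (f ∘ suc)) + (g zero + sumFin (g ∘ suc)) ∎
  where open ≡-Reasoning

sumFin-neg : (f : Fin n → ℚ) → sumFin (λ i → - f i) ≡ - sumFin f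
sumFin-neg {zero}  f = refl
sumFin-neg {suc n} f =
  trans (cong (- f zero +_) (sumFin-neg (f ∘ suc))) (sym (neg-distrib-+ (f zero) _))

*-distribˡ-sumFin : ∀ a (f : Fin n → ℚ) → a * sumFin f ≡ sumFin (λ i → a * f i)
*-distribˡ-sumFin {zero}  a f = *-zeroʳ a
*-distribˡ-sumFin {suc n} a f =
  trans (*-distribˡ-+ a (f zero) _) (cong (a * f zero +_) (*-distribˡ-sumFin a (f ∘ suc)))

sumFin-swap : ∀ {m} (f : Fin m → Fin n → ℚ) →
  sumFin (λ i → sumFin (f i)) ≡ sumFin (λ j → sumFin (λ i → f i j))
sumFin-swap {n} {zero} f = sym (sumFin-zero {n} (λ _ → 0ℚ) (λ _ → refl))
sumFin-swap {m = suc m} f =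
  trans (cong (sumFin (f zero) +_) (sumFin-swap (f ∘ suc))) (sym (sumFin-+ (f zero) _))

sumFin-nonneg : (f : Fin n → ℚ) → (∀ i → 0ℚ ≤ f i) → 0ℚ ≤ sumFin f
sumFin-nonneg {zero}  f f≥0 = ≤-refl
sumFin-nonneg {suc n} f f≥0 = +-mono-≤ (f≥0 zero) (sumFin-nonneg (f ∘ suc) (f≥0 ∘ suc))

sumFin-pos : (f : Fin n → ℚ) → (∀ i → 0ℚ ≤ f i) → ∀ i → 0ℚ < f i → 0ℚ < sumFin f
sumFin-pos {suc n} f f≥0 zero    fi>0 = +-mono-<-≤ fi>0 (sumFin-nonneg (f ∘ suc) (f≥0 ∘ suc))
sumFin-pos {suc n} f f≥0 (suc i) fi>0 = +-mono-≤-< (f≥0 zero) (sumFin-pos (f ∘ suc) (f≥0 ∘ suc) i fi>0)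

dot-sub : (f g x : Fin n → ℚ) → dot (λ i → f i - g i) x ≡ dot f x - dot g x
dot-sub f g x = begin
  sumFin (λ i → (f i - g i) * x i)
    ≡⟨ sumFin-cong (λ i → trans (*-distribʳ-+ (x i) (f i) (- g i))
                                  (cong (f i * x i +_) (sym (neg-distribˡ-* (g i) (x i))))) ⟩
  sumFin (λ i → f i * x i + - (g i * x i))
    ≡⟨ sumFin-+ (λ i → f i * x i) (λ i → - (g i * x i)) ⟩
  dot f x + sumFin (λ i → - (g i * x i))
    ≡⟨ cong (dot f x +_) (sumFin-neg (λ i → g i * x i)) ⟩
  dot f x - dot g x ∎
  where open ≡-Reasoning

dot-zeroʳ : (a : Fin n → ℚ) → dot a (λ _ → 0ℚ) ≡ 0ℚ
dot-zeroʳ a = sumFin-zero _ (*-zeroʳ ∘ a)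

nonneg*nonneg : ∀ {p q} → 0ℚ ≤ p → 0ℚ ≤ q → 0ℚ ≤ p * q
nonneg*nonneg {p} {q} p≥0 q≥0 =
  nonNegative⁻¹ _ {{nonNeg*nonNeg⇒nonNeg p {{nonNegative p≥0}} q {{nonNegative q≥0}}}}

indicator : Subset n → Fin n → ℚ
indicator S i = if lookup S i then 1ℚ else 0ℚ

sumOver≡dot-indicator : (S : Subset n) (x : Fin n → ℚ) → sumOver S x ≡ dot (indicator S) x
sumOver≡dot-indicator S x = sumFin-cong λ i → select (lookup S i) (x i)
  where
  select : ∀ b y → (if b then y else 0ℚ) ≡ (if b then 1ℚ else 0ℚ) * y
  select true  y = sym (*-identityˡ y)
  select false y = sym (*-zeroˡ y)

indicator-∈ : {S : Subset n} {i : Fin n} → i ∈ S → indicator S i ≡ 1ℚ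
indicator-∈ i∈S rewrite []=⇒lookup i∈S = refl

indicator-∉ : {S : Subset n} {i : Fin n} → i ∉ S → indicator S i ≡ 0ℚ
indicator-∉ {S = S} {i} i∉S with lookup S i in eq
... | true  = contradiction (lookup⇒[]= i S eq) i∉S
... | false = refl

indicator-sub-nonneg : (S T : Subset n) (i j : Fin n) →
  (i ∈ S → j ∈ T) → 0ℚ ≤ indicator T j - indicator S i
indicator-sub-nonneg S T i j i∈S⇒j∈T with i ∈? S
... | yes i∈S rewrite indicator-∈ i∈S | indicator-∈ (i∈S⇒j∈T i∈S) = ≤-refl
... | no  i∉S rewrite indicator-∉ i∉S with j ∈? T
...   | yes j∈T rewrite indicator-∈ j∈T = <⇒≤ (positive⁻¹ 1ℚ)
...   | no  j∉T rewrite indicator-∉ j∉T = ≤-refl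

indicator-sub-pos : (S T : Subset n) (i j : Fin n) → j ∈ T → i ∉ S → 0ℚ < indicator T j - indicator S i
indicator-sub-pos S T i j j∈T i∉S rewrite indicator-∈ j∈T | indicator-∉ i∉S = positive⁻¹ 1ℚ

dot-edgeCone : (a x : Fin n → ℚ) (c : Fin n → Fin n → ℚ) →
  (∀ k → x k ≡ sumFin (λ j → c k j + c j k)) →
  dot a x ≡ sumFin (λ k → sumFin (λ j → (a k + a j) * c k j))
dot-edgeCone a x c x≡c = begin
  sumFin (λ k → a k * x k)
    ≡⟨ sumFin-cong (λ k → trans (cong (a k *_) (x≡c k)) (*-distribˡ-sumFin (a k) (λ j → c k j + c j k))) ⟩
  sumFin (λ k → sumFin (λ j → a k * (c k j + c j k)))
    ≡⟨ sumFin-cong (λ k → trans (sumFin-cong (λ j → *-distribˡ-+ (a k) (c k j) (c j k)))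
                                (sumFin-+ (λ j → a k * c k j) (λ j → a k * c j k))) ⟩
  sumFin (λ k → sumFin (λ j → a k * c k j) + sumFin (λ j → a k * c j k))
    ≡⟨ sumFin-+ (λ k → sumFin (λ j → a k * c k j)) (λ k → sumFin (λ j → a k * c j k)) ⟩
  sumFin (λ k → sumFin (λ j → a k * c k j)) + sumFin (λ k → sumFin (λ j → a k * c j k))
    ≡⟨ cong (sumFin (λ k → sumFin (λ j → a k * c k j)) +_) (sumFin-swap (λ k j → a k * c j k)) ⟩
  sumFin (λ k → sumFin (λ j → a k * c k j)) + sumFin (λ k → sumFin (λ j → a j * c k j))
    ≡⟨ sym (sumFin-+ (λ k → sumFin (λ j → a k * c k j)) (λ k → sumFin (λ j → a j * c k j))) ⟩
  sumFin (λ k → sumFin (λ j → a k * c k j) + sumFin (λ j → a j * c k j))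
    ≡⟨ sumFin-cong (λ k → trans (sym (sumFin-+ (λ j → a k * c k j) (λ j → a j * c k j)))
                                (sumFin-cong (λ j → sym (*-distribʳ-+ (c k j) (a k) (a j))))) ⟩
  sumFin (λ k → sumFin (λ j → (a k + a j) * c k j)) ∎
  where open ≡-Reasoning

unitCoeff : Fin n → Fin n → Fin n → Fin n → ℚ
unitCoeff i j k l with k ≟ᶠ i | l ≟ᶠ j
... | yes _ | yes _ = 1ℚ
... | _     | _     = 0ℚ

unitCoeff-at : (i j : Fin n) → unitCoeff i j i j ≡ 1ℚ
unitCoeff-at i j with i ≟ᶠ i | j ≟ᶠ j
... | yes _ | yes _ = refl
... | no i≢i | _     = contradiction refl i≢i
... | yes _ | no j≢j = contradiction refl j≢j

unitCoeff-nonneg : (i j k l : Fin n) → 0ℚ ≤ unitCoeff i j k l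
unitCoeff-nonneg i j k l with k ≟ᶠ i | l ≟ᶠ j
... | yes _ | yes _ = <⇒≤ (positive⁻¹ 1ℚ)
... | yes _ | no _  = ≤-refl
... | no _  | _     = ≤-refl

unitCoeff-nonedge : (G : Graph n) {i j : Fin n} → adj G i j ≡ true →
  ∀ k l → adj G k l ≡ false → unitCoeff i j k l ≡ 0ℚ
unitCoeff-nonedge G {i} {j} ij k l kl with k ≟ᶠ i | l ≟ᶠ j
... | yes refl | yes refl = contradiction (trans (sym ij) kl) λ ()
... | yes _    | no _     = refl
... | no _     | _        = refl

-- e_i + e_j, presented with the single edge-cone coefficient c i j = 1.
edgeVector : Fin n → Fin n → Fin n → ℚ
edgeVector i j k = sumFin (λ l → unitCoeff i j k l + unitCoeff i j l k)

edgeVector∈edgeCone : (G : Graph n) {i j : Fin n} → adj G i j ≡ true → EdgeCone G (edgeVector i j)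
edgeVector∈edgeCone G {i} {j} ij = unitCoeff i j , unitCoeff-nonneg i j , unitCoeff-nonedge G ij , λ _ → refl

0∈edgeCone : (G : Graph n) → EdgeCone G (λ _ → 0ℚ)
0∈edgeCone {n} G = (λ _ _ → 0ℚ) , (λ _ _ → ≤-refl) , (λ _ _ _ → refl) ,
  λ _ → sym (sumFin-zero {n} (λ _ → 0ℚ + 0ℚ) (λ _ → refl))

module _ (G : Graph n) (a : Fin n → ℚ) (a-edge-nonneg : ∀ i j → adj G i j ≡ true → 0ℚ ≤ a i + a j) where

  edgeTerm-nonneg : (c : Fin n → Fin n → ℚ) → (∀ i j → 0ℚ ≤ c i j) →
    (∀ i j → adj G i j ≡ false → c i j ≡ 0ℚ) → ∀ i j → 0ℚ ≤ (a i + a j) * c i j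
  edgeTerm-nonneg c c≥0 c-nonedge i j with adj G i j in ij
  ... | true  = nonneg*nonneg (a-edge-nonneg i j ij) (c≥0 i j)
  ... | false = ≤-reflexive (sym (trans (cong ((a i + a j) *_) (c-nonedge i j ij)) (*-zeroʳ (a i + a j))))

  edgeCone-dot-nonneg : ∀ x → EdgeCone G x → 0ℚ ≤ dot a x
  edgeCone-dot-nonneg x (c , c≥0 , c-nonedge , x≡c) rewrite dot-edgeCone a x c x≡c =
    sumFin-nonneg _ λ i → sumFin-nonneg _ (edgeTerm-nonneg c c≥0 c-nonedge i)

  edgeVector-dot-pos : ∀ {i j} → adj G i j ≡ true → 0ℚ < a i + a j → 0ℚ < dot a (edgeVector i j)
  edgeVector-dot-pos {i} {j} ij aij>0 rewrite dot-edgeCone a (edgeVector i j) (unitCoeff i j) (λ _ → refl) =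
    sumFin-pos _ (λ k → sumFin-nonneg _ (term-nonneg k)) i (sumFin-pos _ (term-nonneg i) j term-pos)
    where
    term-nonneg : ∀ k l → 0ℚ ≤ (a k + a l) * unitCoeff i j k l
    term-nonneg = edgeTerm-nonneg (unitCoeff i j) (unitCoeff-nonneg i j) (unitCoeff-nonedge G ij)

    term-pos : 0ℚ < (a i + a j) * unitCoeff i j i j
    term-pos = subst (0ℚ <_) (sym (trans (cong ((a i + a j) *_) (unitCoeff-at i j)) (*-identityʳ _))) aij>0

anyFin⁺ : (p : Fin n → Bool) (i : Fin n) → p i ≡ true → anyFin p ≡ true
anyFin⁺ p zero    pi≡true rewrite pi≡true = refl
anyFin⁺ p (suc i) pi≡true with p zero
... | true  = refl
... | false = anyFin⁺ (p ∘ suc) i pi≡true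

anyFin⁻ : (p : Fin n → Bool) → anyFin p ≡ true → ∃ λ i → p i ≡ true
anyFin⁻ {suc n} p any-p with p zero in p0
... | true  = zero , p0
... | false with anyFin⁻ (p ∘ suc) any-p
...   | i , pi≡true = suc i , pi≡true

∧≡true⁻ : ∀ {b c} → b ∧ c ≡ true → b ≡ true × c ≡ true
∧≡true⁻ {true} {true} refl = refl , refl

adj-flip : (G : Graph n) {i j : Fin n} → adj G i j ≡ true → adj G j i ≡ true
adj-flip G {i} {j} ij = trans (adj-sym G j i) ij

∈-nbhd⁺ : (G : Graph n) {A : Subset n} {i j : Fin n} → i ∈ A → adj G i j ≡ true → j ∈ nbhd G A
∈-nbhd⁺ G {A} {i} {j} i∈A ij = lookup⇒[]= j (nbhd G A)
  (trans (lookup∘tabulate _ j) (anyFin⁺ _ i (cong₂ _∧_ ([]=⇒lookup i∈A) ij)))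

∈-nbhd⁻ : (G : Graph n) {A : Subset n} {j : Fin n} → j ∈ nbhd G A → ∃ λ i → i ∈ A × adj G i j ≡ true
∈-nbhd⁻ G {A} {j} j∈N
  with anyFin⁻ (λ i → lookup A i ∧ adj G i j) (trans (sym (lookup∘tabulate _ j)) ([]=⇒lookup j∈N))
... | i , Ai∧ij with ∧≡true⁻ Ai∧ij
...   | Ai , ij = i , lookup⇒[]= i A Ai , ij

independent⇒∉nbhd : (G : Graph n) {A : Subset n} → Independent G A → ∀ {i} → i ∈ A → i ∉ nbhd G A
independent⇒∉nbhd G indep i∈A i∈N with ∈-nbhd⁻ G i∈N
... | k , k∈A , ki = contradiction (trans (sym ki) (indep _ _ k∈A i∈A)) λ ()

normalHA : Graph n → Subset n → Fin n → ℚ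
normalHA G A i = indicator (nbhd G A) i - indicator A i

module _ (G : Graph n) (A : Subset n) where

  private
    N : Subset n
    N = nbhd G A

  dot-normalHA : ∀ x → dot (normalHA G A) x ≡ sumOver N x - sumOver A x
  dot-normalHA x = begin
    dot (normalHA G A) x               ≡⟨ dot-sub (indicator N) (indicator A) x ⟩
    dot (indicator N) x - dot (indicator A) x
      ≡⟨ sym (cong₂ _-_ (sumOver≡dot-indicator N x) (sumOver≡dot-indicator A x)) ⟩
    sumOver N x - sumOver A x ∎
    where open ≡-Reasoning

  HA⇒⊥normalHA : ∀ {x} → HA G A x → dot (normalHA G A) x ≡ 0ℚ
  HA⇒⊥normalHA {x} ΣA≡ΣN = trans (dot-normalHA x) (x≈y⇒x∙y⁻¹≈ε (sym ΣA≡ΣN))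

  ⊥normalHA⇒HA : ∀ {x} → dot (normalHA G A) x ≡ 0ℚ → HA G A x
  ⊥normalHA⇒HA {x} ⊥ = sym (x∙y⁻¹≈ε⇒x≈y (sumOver N x) (sumOver A x) (trans (sym (dot-normalHA x)) ⊥))

  -- Regroup so that each bracket compares a vertex of A with a neighbour of it.
  normalHA-edge : ∀ i j → normalHA G A i + normalHA G A j ≡
    (indicator N j - indicator A i) + (indicator N i - indicator A j)
  normalHA-edge i j = solve 4 (λ a b c d → (a :- b) :+ (c :- d) := (c :- b) :+ (a :- d)) refl
    (indicator N i) (indicator A i) (indicator N j) (indicator A j)

  normalHA-edge-nonneg : ∀ i j → adj G i j ≡ true → 0ℚ ≤ normalHA G A i + normalHA G A j
  normalHA-edge-nonneg i j ij = subst (0ℚ ≤_) (sym (normalHA-edge i j)) $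
    +-mono-≤ (indicator-sub-nonneg A N i j λ i∈A → ∈-nbhd⁺ G i∈A ij)
             (indicator-sub-nonneg A N j i λ j∈A → ∈-nbhd⁺ G j∈A (adj-flip G ij))

  normalHA-leaving-pos : ∀ {i j} → adj G i j ≡ true → i ∈ N → j ∉ A →
    0ℚ < normalHA G A i + normalHA G A j
  normalHA-leaving-pos {i} {j} ij i∈N j∉A = subst (0ℚ <_) (sym (normalHA-edge i j)) $
    +-mono-≤-< (indicator-sub-nonneg A N i j λ i∈A → ∈-nbhd⁺ G i∈A ij)
               (indicator-sub-pos A N j i i∈N j∉A)

  normalHA-nonzero : Independent G A → ∀ {i} → i ∈ A → normalHA G A i ≢ 0ℚ
  normalHA-nonzero indep i∈A
    rewrite indicator-∉ (independent⇒∉nbhd G indep i∈A) | indicator-∈ i∈A = λ ()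

module _ {G : Graph n} {W W′ : Subset n} (bip : IsBipartition G W W′) where

  ∈-other⇒∉ : ∀ {i} → i ∈ W′ → i ∉ W
  ∈-other⇒∉ {i} i∈W′ with proj₁ bip i
  ... | inj₁ (_ , i∉W′) = contradiction i∈W′ i∉W′
  ... | inj₂ (_ , i∉W)  = i∉W

  edge-leaves : ∀ {i j} → adj G i j ≡ true → i ∈ W → j ∉ W
  edge-leaves {i} {j} ij i∈W with proj₂ bip i j ij
  ... | inj₁ (_ , j∈W′) = ∈-other⇒∉ j∈W′
  ... | inj₂ (i∈W′ , _) = contradiction i∈W (∈-other⇒∉ i∈W′)

  edge-enters : ∀ {i j} → adj G i j ≡ true → i ∉ W → j ∈ W
  edge-enters {i} {j} ij i∉W with proj₂ bip i j ij
  ... | inj₁ (i∈W , _) = contradiction i∈W i∉W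
  ... | inj₂ (_ , j∈W) = j∈W

IsBipartition-swap : {G : Graph n} {V₁ V₂ : Subset n} → IsBipartition G V₁ V₂ → IsBipartition G V₂ V₁
IsBipartition-swap (part , edges) = (λ i → swap (part i)) , λ i j ij → swap (edges i j ij)

LeavingEdge : Graph n → Subset n → Set
LeavingEdge G A = ∃₂ λ i j → adj G i j ≡ true × i ∈ nbhd G A × j ∉ A

leavingEdge? : (G : Graph n) (A : Subset n) → Dec (LeavingEdge G A)
leavingEdge? G A = any? λ i → any? λ j →
  (adj G i j ≟ᵇ true) ×-dec (i ∈? nbhd G A) ×-dec ¬? (j ∈? A)

module _ {G : Graph n} {A : Subset n} (conn : Connected G) (indep : Independent G A)
         (¬leaving : ¬ LeavingEdge G A) where

  nbhd-closed : ∀ {i j} → adj G i j ≡ true → i ∈ nbhd G A → j ∈ A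
  nbhd-closed {i} {j} ij i∈N with j ∈? A
  ... | yes j∈A = j∈A
  ... | no  j∉A = contradiction (i , j , ij , i∈N , j∉A) ¬leaving

  -- Along any walk ending in a₀ ∈ A ∩ W, the vertices alternate between A ∩ W and N(A) ∖ W.
  ¬leaving⇒class : ∀ {W W′} → IsBipartition G W W′ → ∀ {a₀} → a₀ ∈ A → a₀ ∈ W → A ≡ W
  ¬leaving⇒class {W} {W′} bip {a₀} a₀∈A a₀∈W = ⊆-antisym A⊆W W⊆A
    where
    alternating : ∀ {k} → Reach G k a₀ → (k ∈ A × k ∈ W) ⊎ (k ∈ nbhd G A × k ∉ W)
    alternating here = inj₁ (a₀∈A , a₀∈W)
    alternating (step kj walk) with adj-flip G kj | alternating walk
    ... | jk | inj₁ (j∈A , j∈W) = inj₂ (∈-nbhd⁺ G j∈A jk , edge-leaves {G = G} {W′ = W′} bip jk j∈W)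
    ... | jk | inj₂ (j∈N , j∉W) = inj₁ (nbhd-closed jk j∈N , edge-enters {G = G} {W′ = W′} bip jk j∉W)

    A⊆W : ∀ {k} → k ∈ A → k ∈ W
    A⊆W {k} k∈A with alternating (conn k a₀)
    ... | inj₁ (_ , k∈W)   = k∈W
    ... | inj₂ (k∈N , _)   = contradiction k∈N (independent⇒∉nbhd G indep k∈A)

    W⊆A : ∀ {k} → k ∈ W → k ∈ A
    W⊆A {k} k∈W with alternating (conn k a₀)
    ... | inj₁ (k∈A , _)   = k∈A
    ... | inj₂ (_ , k∉W)   = contradiction k∈W k∉W

  ¬leaving⇒bipartitionClass : ∀ {V₁ V₂} → IsBipartition G V₁ V₂ → Nonempty A → A ≡ V₁ ⊎ A ≡ V₂
  ¬leaving⇒bipartitionClass {V₁} {V₂} bip (a₀ , a₀∈A) with proj₁ bip a₀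
  ... | inj₁ (a₀∈V₁ , _) = inj₁ (¬leaving⇒class bip a₀∈A a₀∈V₁)
  ... | inj₂ (a₀∈V₂ , _) = inj₂ (¬leaving⇒class (IsBipartition-swap {G = G} {V₁ = V₁} bip) a₀∈A a₀∈V₂)

proposition4p1 : (n : ℕ) (G : Graph n) (V₁ V₂ : Subset n) →
    Connected G → IsBipartition G V₁ V₂ →
    (A : Subset n) → Nonempty A → Independent G A → A ≢ V₁ → A ≢ V₂ →
    IsProperFace (EdgeCone G) (λ x → EdgeCone G x × HA G A x)
proposition4p1 n G V₁ V₂ conn bip A A≠∅@(a₀ , a₀∈A) indep A≢V₁ A≢V₂ =
  face , outside (leavingEdge? G A) , (λ _ → 0ℚ) , 0∈edgeCone G , ⊥normalHA⇒HA G A (dot-zeroʳ a)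
  where
  a : Fin n → ℚ
  a = normalHA G A

  face : IsFace (EdgeCone G) (λ x → EdgeCone G x × HA G A x)
  face = a , (a₀ , normalHA-nonzero G A indep a₀∈A) ,
    inj₁ (edgeCone-dot-nonneg G a (normalHA-edge-nonneg G A)) ,
    λ x → (λ (x∈Q , x∈HA) → x∈Q , HA⇒⊥normalHA G A x∈HA) ,
          (λ (x∈Q , a·x≡0) → x∈Q , ⊥normalHA⇒HA G A a·x≡0)

  outside : Dec (LeavingEdge G A) → ∃ λ x → EdgeCone G x × ¬ (EdgeCone G x × HA G A x)
  outside (yes (i , j , ij , i∈N , j∉A)) =
    edgeVector i j , edgeVector∈edgeCone G ij , λ (_ , x∈HA) →
      <⇒≢ (edgeVector-dot-pos G a (normalHA-edge-nonneg G A) ij (normalHA-leaving-pos G A ij i∈N j∉A))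
          (sym (HA⇒⊥normalHA G A x∈HA))
  outside (no ¬leaving) with ¬leaving⇒bipartitionClass conn indep ¬leaving bip A≠∅
  ... | inj₁ A≡V₁ = contradiction A≡V₁ A≢V₁
  ... | inj₂ A≡V₂ = contradiction A≡V₂ A≢V₂
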